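{- Let $A$ be a commutative pseudo-BCI algebra and define $d_{\varphi}:A\to A$ by $d_{\varphi}(x)=\varphi_x=(x\to 1)\rightsquigarrow 1$ for all $x\in A$. Then $d_{\varphi}$ is both a type I and a type II implicative derivation on $A$, i.e. $d_{\varphi}\in \mathcal{IDOP}(A)$.
   Context: A pseudo-BCI algebra is a structure $(A,\to,\rightsquigarrow,1)$ of type $(2,2,0)$ such that for all $x,y,z\in A$: $(x\to y)\rightsquigarrow[(y\to z)\rightsquigarrow(x\to z)]=1$; $(x\rightsquigarrow y)\to[(y\rightsquigarrow z)\to(x\rightsquigarrow z)]=1$; $1\to x=x$; $1\rightsquigarrow x=x$; and $x\to y=1$, $y\to x=1$ imply $x=y$. Write $x\le y$ iff $x\to y=1$ (equivalently $x\rightsquigarrow y=1$). Put $x\Cup_1 y=(x\to y)\rightsquigarrow y$ and $x\Cup_2 y=(x\rightsquigarrow y)\to y$. $A$ is called commutative if $x\Cup_1 y=x\Cup_2 y=x$ whenever $y\le x$. A map $d:A\to A$ is a type I implicative derivation if $d(x\to y)=(x\to d(y))\Cup_2(d(x)\to y)$ and $d(x\rightsquigarrow y)=(x\rightsquigarrow d(y))\Cup_1(d(x)\rightsquigarrow y)$ for all $x,y$; it is a type II implicative derivation if $d(x\to y)=(d(x)\to y)\Cup_2(x\to d(y))$ and $d(x\rightsquigarrow y)=(d(x)\rightsquigarrow y)\Cup_1(x\rightsquigarrow d(y))$ for all $x,y$. $\mathcal{IDOP}(A)$ denotes the set of maps that are both type I and type II implicative derivations. -}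

module Defs where

open import Level using (Level; suc)
open import Relation.Binary.PropositionalEquality using (_≡_)

record PseudoBCI (a : Level) : Set (suc a) where
  infixr 5 _⇒_ _⇝_
  field
    Carrier : Set a
    _⇒_     : Carrier → Carrier → Carrier
    _⇝_     : Carrier → Carrier → Carrier
    𝟙       : Carrier
    ax1 : ∀ x y z → (x ⇒ y) ⇝ ((y ⇒ z) ⇝ (x ⇒ z)) ≡ 𝟙
    ax2 : ∀ x y z → (x ⇝ y) ⇒ ((y ⇝ z) ⇒ (x ⇝ z)) ≡ 𝟙
    ax3 : ∀ x → 𝟙 ⇒ x ≡ x
    ax4 : ∀ x → 𝟙 ⇝ x ≡ x
    ax5 : ∀ x y → x ⇒ y ≡ 𝟙 → y ⇒ x ≡ 𝟙 → x ≡ y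

  _≤_ : Carrier → Carrier → Set a
  x ≤ y = x ⇒ y ≡ 𝟙

  _⋓₁_ : Carrier → Carrier → Carrier
  x ⋓₁ y = (x ⇒ y) ⇝ y

  _⋓₂_ : Carrier → Carrier → Carrier
  x ⋓₂ y = (x ⇝ y) ⇒ y



module _ {a : Level} (A : PseudoBCI a) where
  open PseudoBCI A renaming (Carrier to C)
  open import Data.Product using (_×_)

  IsCommutative : Set a
  IsCommutative = ∀ x y → y ≤ x → (x ⋓₁ y ≡ x) × (x ⋓₂ y ≡ x)

  IsTypeI : (C → C) → Set a
  IsTypeI d = (∀ x y → d (x ⇒ y) ≡ (x ⇒ d y) ⋓₂ (d x ⇒ y))
            × (∀ x y → d (x ⇝ y) ≡ (x ⇝ d y) ⋓₁ (d x ⇝ y))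

  IsTypeII : (C → C) → Set a
  IsTypeII d = (∀ x y → d (x ⇒ y) ≡ (d x ⇒ y) ⋓₂ (x ⇒ d y))
             × (∀ x y → d (x ⇝ y) ≡ (d x ⇝ y) ⋓₁ (x ⇝ d y))

  InIDOP : (C → C) → Set a
  InIDOP d = IsTypeI d × IsTypeII d

  dφ : C → C
  dφ x = (x ⇒ 𝟙) ⇝ 𝟙

module Submission where

-- In every pseudo-BCI algebra x ≤ φ x, and x ↦ x → 1 is constant along ≤, so each φ y is a
-- maximal element. Commutativity makes maximal elements closed under x → _ and x ⇝ _: if
-- x → m ≤ w, then w = (w → (x → m)) ⇝ (x → m) = x → ((w → (x → m)) ⇝ m) = x → m, because
-- w → (x → m) ≤ 1 and a maximal m absorbs such a premise. Hence φ (x → y) = φ (x → φ y) = x → φ y,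
-- and as φ x → y ≤ x → φ y, every join in the four derivation identities collapses to x → φ y.

open import Defs
open import Level using (Level)
open import Data.Product using (_,_; proj₁; proj₂)
open import Relation.Binary.Bundles using (Preorder)
open import Relation.Binary.PropositionalEquality
import Relation.Binary.Reasoning.Preorder as PreorderReasoning

module PseudoBCIProperties {a : Level} (A : PseudoBCI a) where
  open PseudoBCI A renaming (Carrier to C)

  ⇝-mp : ∀ {x y} → x ≡ 𝟙 → x ⇝ y ≡ 𝟙 → y ≡ 𝟙
  ⇝-mp {x} {y} x≡𝟙 x⇝y≡𝟙 = trans (sym (ax4 y)) (subst (λ u → u ⇝ y ≡ 𝟙) x≡𝟙 x⇝y≡𝟙)

  ⇒-mp : ∀ {x y} → x ≡ 𝟙 → x ⇒ y ≡ 𝟙 → y ≡ 𝟙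
  ⇒-mp {x} {y} x≡𝟙 x⇒y≡𝟙 = trans (sym (ax3 y)) (subst (λ u → u ⇒ y ≡ 𝟙) x≡𝟙 x⇒y≡𝟙)

  ≤-⋓₂ : ∀ x y → x ≤ (x ⋓₂ y)
  ≤-⋓₂ x y = subst₂ (λ u v → u ⇒ ((x ⇝ y) ⇒ v) ≡ 𝟙) (ax4 x) (ax4 y) (ax2 𝟙 x y)

  ⇝-⋓₁ : ∀ x y → x ⇝ (x ⋓₁ y) ≡ 𝟙
  ⇝-⋓₁ x y = subst₂ (λ u v → u ⇝ ((x ⇒ y) ⇝ v) ≡ 𝟙) (ax3 x) (ax3 y) (ax1 𝟙 x y)

  ⇝≡𝟙→≤ : ∀ {x y} → x ⇝ y ≡ 𝟙 → x ≤ y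
  ⇝≡𝟙→≤ {x} {y} x⇝y≡𝟙 =
    subst (λ u → x ≤ u) (trans (cong (_⇒ y) x⇝y≡𝟙) (ax3 y)) (≤-⋓₂ x y)

  ≤→⇝≡𝟙 : ∀ {x y} → x ≤ y → x ⇝ y ≡ 𝟙
  ≤→⇝≡𝟙 {x} {y} x≤y =
    subst (λ u → x ⇝ u ≡ 𝟙) (trans (cong (_⇝ y) x≤y) (ax4 y)) (⇝-⋓₁ x y)

  ≤-⋓₁ : ∀ x y → x ≤ (x ⋓₁ y)
  ≤-⋓₁ x y = ⇝≡𝟙→≤ (⇝-⋓₁ x y)

  ⇒-refl : ∀ x → x ⇒ x ≡ 𝟙
  ⇒-refl x = subst (λ u → u ⇒ u ≡ 𝟙) (ax4 x) (⇒-mp (ax4 𝟙) (ax2 𝟙 𝟙 x))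

  ⇝-refl : ∀ x → x ⇝ x ≡ 𝟙
  ⇝-refl x = ≤→⇝≡𝟙 (⇒-refl x)

  ≤-trans : ∀ {x y z} → x ≤ y → y ≤ z → x ≤ z
  ≤-trans {x} {y} {z} x≤y y≤z = ⇝-mp y≤z (⇝-mp x≤y (ax1 x y z))

  ≤-preorder : Preorder a a a
  ≤-preorder = record
    { Carrier    = C
    ; _≈_        = _≡_
    ; _≲_        = _≤_
    ; isPreorder = record
      { isEquivalence = isEquivalence
      ; reflexive     = λ { refl → ⇒-refl _ }
      ; trans         = ≤-trans
      }
    }

  open PreorderReasoning ≤-preorder

  ⇒-antimonoˡ-≤ : ∀ {x y} z → x ≤ y → (y ⇒ z) ≤ (x ⇒ z)
  ⇒-antimonoˡ-≤ {x} {y} z x≤y = ⇝≡𝟙→≤ (⇝-mp x≤y (ax1 x y z))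

  ⇝-antimonoˡ-≤ : ∀ {x y} z → x ≤ y → (y ⇝ z) ≤ (x ⇝ z)
  ⇝-antimonoˡ-≤ {x} {y} z x≤y = ⇒-mp (≤→⇝≡𝟙 x≤y) (ax2 x y z)

  ⇒-monoʳ-≤ : ∀ x {y z} → y ≤ z → (x ⇒ y) ≤ (x ⇒ z)
  ⇒-monoʳ-≤ x {y} {z} y≤z = begin
    x ⇒ y                   ≲⟨ ⇝≡𝟙→≤ (ax1 x y z) ⟩
    (y ⇒ z) ⇝ (x ⇒ z)       ≡⟨ cong (_⇝ (x ⇒ z)) y≤z ⟩
    𝟙 ⇝ (x ⇒ z)             ≡⟨ ax4 (x ⇒ z) ⟩
    x ⇒ z                   ∎

  ⇝-monoʳ-≤ : ∀ x {y z} → y ≤ z → (x ⇝ y) ≤ (x ⇝ z)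
  ⇝-monoʳ-≤ x {y} {z} y≤z = begin
    x ⇝ y                   ≲⟨ ax2 x y z ⟩
    (y ⇝ z) ⇒ (x ⇝ z)       ≡⟨ cong (_⇒ (x ⇝ z)) (≤→⇝≡𝟙 y≤z) ⟩
    𝟙 ⇒ (x ⇝ z)             ≡⟨ ax3 (x ⇝ z) ⟩
    x ⇝ z                   ∎

  ⇒-⇝-exchange : ∀ x y z → x ⇒ (y ⇝ z) ≡ y ⇝ (x ⇒ z)
  ⇒-⇝-exchange x y z = ax5 _ _ ≤-exchange ≥-exchange
    where
    ≤-exchange : (x ⇒ (y ⇝ z)) ≤ (y ⇝ (x ⇒ z))
    ≤-exchange = begin
      x ⇒ (y ⇝ z)               ≲⟨ ⇝≡𝟙→≤ (ax1 x (y ⇝ z) z) ⟩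
      (y ⋓₂ z) ⇝ (x ⇒ z)        ≲⟨ ⇝-antimonoˡ-≤ (x ⇒ z) (≤-⋓₂ y z) ⟩
      y ⇝ (x ⇒ z)               ∎
    ≥-exchange : (y ⇝ (x ⇒ z)) ≤ (x ⇒ (y ⇝ z))
    ≥-exchange = begin
      y ⇝ (x ⇒ z)               ≲⟨ ax2 y (x ⇒ z) z ⟩
      (x ⋓₁ z) ⇒ (y ⇝ z)        ≲⟨ ⇒-antimonoˡ-≤ (y ⇝ z) (≤-⋓₁ x z) ⟩
      x ⇒ (y ⇝ z)               ∎

  ⋓₁-absorbs-≤ : ∀ {x y} → x ≤ y → (x ⋓₁ y) ≡ y
  ⋓₁-absorbs-≤ {x} {y} x≤y = trans (cong (_⇝ y) x≤y) (ax4 y)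

  ⋓₂-absorbs-≤ : ∀ {x y} → x ≤ y → (x ⋓₂ y) ≡ y
  ⋓₂-absorbs-≤ {x} {y} x≤y = trans (cong (_⇒ y) (≤→⇝≡𝟙 x≤y)) (ax3 y)

  ⇝𝟙≤⇒𝟙 : ∀ x → (x ⇝ 𝟙) ≤ (x ⇒ 𝟙)
  ⇝𝟙≤⇒𝟙 x = begin
    x ⇝ 𝟙                   ≲⟨ ax2 x 𝟙 x ⟩
    (𝟙 ⇝ x) ⇒ (x ⇝ x)       ≡⟨ cong₂ _⇒_ (ax4 x) (⇝-refl x) ⟩
    x ⇒ 𝟙                   ∎

  ⇒𝟙-invariant : ∀ {x y} → x ≤ y → x ⇒ 𝟙 ≡ y ⇒ 𝟙
  ⇒𝟙-invariant {x} {y} x≤y = ax5 _ _ ≤-invariant (⇒-antimonoˡ-≤ 𝟙 x≤y)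
    where
    ≤-invariant : (x ⇒ 𝟙) ≤ (y ⇒ 𝟙)
    ≤-invariant = begin
      x ⇒ 𝟙                   ≲⟨ ⇝≡𝟙→≤ (ax1 x 𝟙 y) ⟩
      (𝟙 ⇒ y) ⇝ (x ⇒ y)       ≡⟨ cong₂ _⇝_ (ax3 y) x≤y ⟩
      y ⇝ 𝟙                   ≲⟨ ⇝𝟙≤⇒𝟙 y ⟩
      y ⇒ 𝟙                   ∎

  Maximal : C → Set a
  Maximal m = ∀ {x} → m ≤ x → x ≡ m

  φ : C → C
  φ = dφ A

  ≤-φ : ∀ x → x ≤ φ x
  ≤-φ x = ≤-⋓₁ x 𝟙

  φ-maximal : ∀ x → Maximal (φ x)
  φ-maximal x {y} φx≤y = ax5 _ _ y≤φx φx≤y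
    where
    y≤φx : y ≤ φ x
    y≤φx = subst (λ u → y ≤ (u ⇝ 𝟙))
                 (trans (sym (⇒𝟙-invariant φx≤y)) (sym (⇒𝟙-invariant (≤-φ x))))
                 (≤-φ y)

  φ-fixes-maximal : ∀ {m} → Maximal m → φ m ≡ m
  φ-fixes-maximal max = max (≤-φ _)

  ⇝-absorbs-maximal : ∀ {k m} → k ≤ 𝟙 → Maximal m → k ⇝ m ≡ m
  ⇝-absorbs-maximal {k} {m} k≤𝟙 max =
    max (subst (λ u → u ≤ (k ⇝ m)) (ax4 m) (⇝-antimonoˡ-≤ m k≤𝟙))

  ⇒-absorbs-maximal : ∀ {k m} → k ≤ 𝟙 → Maximal m → k ⇒ m ≡ m
  ⇒-absorbs-maximal {k} {m} k≤𝟙 max =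
    max (subst (λ u → u ≤ (k ⇒ m)) (ax3 m) (⇒-antimonoˡ-≤ m k≤𝟙))

  ⇒-below-𝟙 : ∀ {x y} → x ≤ y → (y ⇒ x) ≤ 𝟙
  ⇒-below-𝟙 {x} x≤y = subst (λ u → _ ≤ u) (⇒-refl x) (⇒-antimonoˡ-≤ x x≤y)

  ⇝-below-𝟙 : ∀ {x y} → x ≤ y → (y ⇝ x) ≤ 𝟙
  ⇝-below-𝟙 {x} x≤y = subst (λ u → _ ≤ u) (⇝-refl x) (⇝-antimonoˡ-≤ x x≤y)

module CommutativePseudoBCIProperties {a : Level} (A : PseudoBCI a) (comm : IsCommutative A) where
  open PseudoBCI A
  open PseudoBCIProperties A

  ⇒-preserves-maximal : ∀ x {m} → Maximal m → Maximal (x ⇒ m)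
  ⇒-preserves-maximal x {m} max {w} x⇒m≤w = begin
    w                             ≡⟨ sym (proj₁ (comm w (x ⇒ m) x⇒m≤w)) ⟩
    (w ⇒ (x ⇒ m)) ⇝ (x ⇒ m)       ≡⟨ sym (⇒-⇝-exchange x (w ⇒ (x ⇒ m)) m) ⟩
    x ⇒ ((w ⇒ (x ⇒ m)) ⇝ m)       ≡⟨ cong (x ⇒_) (⇝-absorbs-maximal (⇒-below-𝟙 x⇒m≤w) max) ⟩
    x ⇒ m                         ∎
    where open ≡-Reasoning

  ⇝-preserves-maximal : ∀ x {m} → Maximal m → Maximal (x ⇝ m)
  ⇝-preserves-maximal x {m} max {w} x⇝m≤w = begin
    w                             ≡⟨ sym (proj₂ (comm w (x ⇝ m) x⇝m≤w)) ⟩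
    (w ⇝ (x ⇝ m)) ⇒ (x ⇝ m)       ≡⟨ ⇒-⇝-exchange (w ⇝ (x ⇝ m)) x m ⟩
    x ⇝ ((w ⇝ (x ⇝ m)) ⇒ m)       ≡⟨ cong (x ⇝_) (⇒-absorbs-maximal (⇝-below-𝟙 x⇝m≤w) max) ⟩
    x ⇝ m                         ∎
    where open ≡-Reasoning

  φ-⇒ : ∀ x y → φ (x ⇒ y) ≡ x ⇒ φ y
  φ-⇒ x y = trans (cong (_⇝ 𝟙) (⇒𝟙-invariant (⇒-monoʳ-≤ x (≤-φ y))))
                  (φ-fixes-maximal (⇒-preserves-maximal x (φ-maximal y)))

  φ-⇝ : ∀ x y → φ (x ⇝ y) ≡ x ⇝ φ y
  φ-⇝ x y = trans (cong (_⇝ 𝟙) (⇒𝟙-invariant (⇝-monoʳ-≤ x (≤-φ y))))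
                  (φ-fixes-maximal (⇝-preserves-maximal x (φ-maximal y)))

  φˡ-⇒≤φʳ-⇒ : ∀ x y → (φ x ⇒ y) ≤ (x ⇒ φ y)
  φˡ-⇒≤φʳ-⇒ x y = ≤-trans (⇒-antimonoˡ-≤ y (≤-φ x)) (⇒-monoʳ-≤ x (≤-φ y))

  φˡ-⇝≤φʳ-⇝ : ∀ x y → (φ x ⇝ y) ≤ (x ⇝ φ y)
  φˡ-⇝≤φʳ-⇝ x y = ≤-trans (⇝-antimonoˡ-≤ y (≤-φ x)) (⇝-monoʳ-≤ x (≤-φ y))

theorem3p8 : {a : Level} (A : PseudoBCI a) → IsCommutative A → InIDOP A (dφ A)
theorem3p8 A comm =
  ( (λ x y → trans (φ-⇒ x y) (sym (proj₂ (comm _ _ (φˡ-⇒≤φʳ-⇒ x y)))))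
  , (λ x y → trans (φ-⇝ x y) (sym (proj₁ (comm _ _ (φˡ-⇝≤φʳ-⇝ x y))))) )
  , ( (λ x y → trans (φ-⇒ x y) (sym (⋓₂-absorbs-≤ (φˡ-⇒≤φʳ-⇒ x y))))
    , (λ x y → trans (φ-⇝ x y) (sym (⋓₁-absorbs-≤ (φˡ-⇝≤φʳ-⇝ x y)))) )
  where
  open PseudoBCIProperties A
  open CommutativePseudoBCIProperties A comm
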